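{- Let $k$ be a positive integer and let $G$ be an $(n-k-1)$-regular graph on $n$ vertices. Then $\mathrm{box}(G)\ge \frac{n}{2k}$.
   Context: Graphs are finite, simple and undirected. The boxicity $\mathrm{box}(G)$ is the minimum $k$ such that there are interval graphs $I_1,\dots,I_k$ on $V(G)$ with $E(G)=E(I_1)\cap\cdots\cap E(I_k)$ (equivalently, the minimum dimension of an intersection representation of $G$ by axis-parallel boxes). -}

module Defs where

open import Data.Nat using (ℕ; _≤_)
open import Data.Bool using (Bool; true; false; T)
open import Data.Bool.Properties using (T?)
open import Data.Fin using (Fin)
open import Data.List using (allFin; filter; length)
open import Data.Product using (Σ; _×_; ∃)
open import Relation.Binary.PropositionalEquality using (_≡_; _≢_)
open import Function.Bundles using (_⇔_)
open import Relation.Nullary using (¬_)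

record Graph (n : ℕ) : Set where
  field
    adj     : Fin n → Fin n → Bool
    sym     : ∀ u v → adj u v ≡ adj v u
    irrefl  : ∀ v → adj v v ≡ false
open Graph public

degree : ∀ {n} → Graph n → Fin n → ℕ
degree G v = length (filter (λ u → T? (adj G v u)) (allFin _))

Regular : ∀ {n} → ℕ → Graph n → Set
Regular d G = ∀ v → degree G v ≡ d

IsIntervalGraph : ∀ {n} → Graph n → Set
IsIntervalGraph {n} H =
  Σ (Fin n → ℕ) λ l → Σ (Fin n → ℕ) λ r →
    (∀ v → l v ≤ r v) ×
    (∀ u v → u ≢ v → (T (adj H u v) ⇔ (l u ≤ r v × l v ≤ r u)))

IsBoxRepresentation : ∀ {n m} → Graph n → (Fin m → Graph n) → Set
IsBoxRepresentation {n} G I =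
  (∀ j → IsIntervalGraph (I j)) ×
  (∀ u v → u ≢ v → T (adj G u v) ⇔ (∀ j → T (adj (I j) u v)))

BoxicityAtMost : ∀ {n} → Graph n → ℕ → Set
BoxicityAtMost {n} G m = Σ (Fin m → Graph n) λ I → IsBoxRepresentation G I

{-# OPTIONS --safe #-}
-- In each interval graph Iⱼ of the representation let aⱼ be the vertex whose interval
-- ends first and bⱼ the one whose interval starts last. As k ≥ 1, every vertex v has a
-- non-neighbour u in G; v and u are non-adjacent in some Iⱼ, so v's interval lies left of
-- bⱼ's or right of aⱼ's, and v is a non-neighbour of bⱼ or aⱼ in Iⱼ, hence in G. By
-- regularity each vertex has exactly k non-neighbours, so the 2m non-neighbourhoods of the
-- aⱼ and bⱼ cover all n vertices and n ≤ 2km.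
module Submission where

open import Defs
open import Data.Nat using (ℕ; _+_; _*_; _≤_)
open import Relation.Binary.PropositionalEquality using (_≡_)

open import Data.Bool using (Bool; true; false; T; not; _∧_; _∨_; if_then_else_)
open import Data.Bool.Properties using (T?; T-∧; T-∨; T-not-≡)
open import Data.Fin using (Fin; zero; suc)
open import Data.Fin.Properties using (_≟_; ¬∀⟶∃¬)
open import Data.List using (allFin; filter; length; tabulate)
open import Data.List.Extrema.Nat using (argmin; argmax; f[argmin]≤f[xs]; f[xs]≤f[argmax])
open import Data.List.Membership.Propositional.Properties using (∈-allFin)
open import Data.List.Relation.Unary.All using (lookup)
open import Data.Nat using (zero; suc; _<_; z≤n; s≤s; _≤?_)
open import Data.Nat.Properties
  using ( +-assoc; +-comm; +-identityʳ; +-suc; +-cancelʳ-≡; *-comm; +-mono-≤; +-monoˡ-≤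
        ; ≤-reflexive; ≤-trans; m≤m+n; m≤n⇒m≤1+n; <-≤-trans; ≤-<-trans; <⇒≱; ≰⇒>; module ≤-Reasoning )
open import Data.Product using (∃-syntax; _×_; _,_; proj₁; proj₂)
open import Data.Sum using (_⊎_; inj₁; inj₂; [_,_])
import Data.Sum as Sum
open import Data.Unit using (tt)
open import Function using (_∘_; id; case_of_)
open import Function.Bundles using (_⇔_; mk⇔; Equivalence)
open import Relation.Binary.PropositionalEquality using (refl; trans; cong; cong₂; _≢_; module ≡-Reasoning)
import Relation.Binary.PropositionalEquality as ≡
open import Relation.Nullary using (¬_; yes; no; does; contradiction)

count : ∀ {n} → (Fin n → Bool) → ℕ
count {zero}  p = 0
count {suc n} p = (if p zero then 1 else 0) + count (p ∘ suc)

length-filter-tabulate : ∀ {n N} (f : Fin n → Fin N) (p : Fin N → Bool) →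
  length (filter (T? ∘ p) (tabulate f)) ≡ count (p ∘ f)
length-filter-tabulate {zero}  f p = refl
length-filter-tabulate {suc n} f p with p (f zero)
... | true  = cong suc (length-filter-tabulate (f ∘ suc) p)
... | false = length-filter-tabulate (f ∘ suc) p

count-true : ∀ {n} → count {n} (λ _ → true) ≡ n
count-true {zero}  = refl
count-true {suc n} = cong suc (count-true {n})

count-none : ∀ {n} (p : Fin n → Bool) → (∀ u → ¬ T (p u)) → count p ≡ 0
count-none {zero}  p none = refl
count-none {suc n} p none with p zero | none zero
... | true  | ¬t = contradiction tt ¬t
... | false | _  = count-none (p ∘ suc) (none ∘ suc)

count-mono : ∀ {n} (p q : Fin n → Bool) → (∀ u → T (p u) → T (q u)) → count p ≤ count q
count-mono {zero}  p q p⊆q = z≤n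
count-mono {suc n} p q p⊆q with p zero | q zero | p⊆q zero
... | true  | true  | _ = s≤s (count-mono (p ∘ suc) (q ∘ suc) (p⊆q ∘ suc))
... | true  | false | t = contradiction (t tt) λ ()
... | false | true  | _ = m≤n⇒m≤1+n (count-mono (p ∘ suc) (q ∘ suc) (p⊆q ∘ suc))
... | false | false | _ = count-mono (p ∘ suc) (q ∘ suc) (p⊆q ∘ suc)

count-not : ∀ {n} (p : Fin n → Bool) → count (not ∘ p) + count p ≡ n
count-not {zero}  p = refl
count-not {suc n} p with p zero
... | true  = trans (+-suc _ _) (cong suc (count-not (p ∘ suc)))
... | false = cong suc (count-not (p ∘ suc))

count-∨-∧ : ∀ {n} (p q : Fin n → Bool) →
  count (λ u → p u ∨ q u) + count (λ u → p u ∧ q u) ≡ count p + count q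
count-∨-∧ {zero}  p q = refl
count-∨-∧ {suc n} p q with p zero | q zero | count-∨-∧ (p ∘ suc) (q ∘ suc)
... | true  | true  | ih = cong suc (trans (+-suc _ _) (trans (cong suc ih) (≡.sym (+-suc _ _))))
... | true  | false | ih = cong suc ih
... | false | true  | ih = trans (cong suc ih) (≡.sym (+-suc _ _))
... | false | false | ih = ih

count-split : ∀ {n} (p q : Fin n → Bool) →
  count p ≡ count (λ u → p u ∧ q u) + count (λ u → p u ∧ not (q u))
count-split {zero}  p q = refl
count-split {suc n} p q with p zero | q zero | count-split (p ∘ suc) (q ∘ suc)
... | true  | true  | ih = cong suc ih
... | true  | false | ih = trans (cong suc ih) (≡.sym (+-suc _ _))
... | false | _     | ih = ih

count-∨ : ∀ {n} (p q : Fin n → Bool) → count (λ u → p u ∨ q u) ≤ count p + count q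
count-∨ p q = ≤-trans (m≤m+n _ _) (≤-reflexive (count-∨-∧ p q))

count-singleton : ∀ {n} (x : Fin n) → count (λ u → does (x ≟ u)) ≡ 1
count-singleton {suc n} zero    = cong suc (count-none {n} _ λ _ ())
count-singleton {suc n} (suc x) = count-singleton x

0<count⇒∃ : ∀ {n} (p : Fin n → Bool) → 0 < count p → ∃[ u ] T (p u)
0<count⇒∃ {suc n} p 0<c with p zero in p₀
... | true  = zero , ≡.subst T (≡.sym p₀) tt
... | false with 0<count⇒∃ (p ∘ suc) 0<c
...   | u , t = suc u , t

covered⇒count≤m*c : ∀ {n m} c (p : Fin n → Bool) (Q : Fin m → Fin n → Bool) →
  (∀ j → count (Q j) ≤ c) → (∀ u → T (p u) → ∃[ j ] T (Q j u)) → count p ≤ m * c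
covered⇒count≤m*c {m = zero} c p Q bound cover =
  ≤-reflexive (count-none p λ u t → case cover u t of λ ())
covered⇒count≤m*c {m = suc m} c p Q bound cover = begin
  count p                                            ≡⟨ count-split p (Q zero) ⟩
  count (λ u → p u ∧ Q zero u) + count (λ u → p u ∧ not (Q zero u))
    ≤⟨ +-mono-≤ (count-mono _ (Q zero) λ u t → proj₂ (Equivalence.to T-∧ t))
                (covered⇒count≤m*c c _ (Q ∘ suc) (bound ∘ suc) rest) ⟩
  count (Q zero) + m * c                             ≤⟨ +-monoˡ-≤ (m * c) (bound zero) ⟩
  suc m * c                                          ∎
  where
  open ≤-Reasoning
  rest : ∀ u → T (p u ∧ not (Q zero u)) → ∃[ j ] T (Q (suc j) u)
  rest u t with Equivalence.to T-∧ t
  ... | pu , ¬q₀ with cover u pu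
  ...   | zero  , q₀ = contradiction (≡.subst T (Equivalence.to T-not-≡ ¬q₀) q₀) λ ()
  ...   | suc j , qj = j , qj

Nonadjacent : ∀ {n} → Graph n → Fin n → Fin n → Set
Nonadjacent G u v = u ≢ v × ¬ T (adj G u v)

Nonadjacent-sym : ∀ {n} (G : Graph n) {u v} → Nonadjacent G u v → Nonadjacent G v u
Nonadjacent-sym G {u} {v} (u≢v , ¬uv) = u≢v ∘ ≡.sym , ¬uv ∘ ≡.subst T (Graph.sym G v u)

closedNbr : ∀ {n} → Graph n → Fin n → Fin n → Bool
closedNbr G x u = adj G x u ∨ does (x ≟ u)

nonNbr : ∀ {n} → Graph n → Fin n → Fin n → Bool
nonNbr G x u = not (closedNbr G x u)

T-nonNbr : ∀ {n} (G : Graph n) x v → T (nonNbr G x v) ⇔ Nonadjacent G x v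
T-nonNbr G x v with adj G x v | x ≟ v
... | true  | _        = mk⇔ (λ ()) (λ (_ , ¬xv) → contradiction tt ¬xv)
... | false | yes refl = mk⇔ (λ ()) (λ (x≢x , _) → contradiction refl x≢x)
... | false | no x≢v   = mk⇔ (λ _ → x≢v , λ ()) (λ _ → tt)

module RegularGraph {n d} {G : Graph n} (regular : Regular d G) where

  count-adj : ∀ x → count (adj G x) ≡ d
  count-adj x = trans (≡.sym (length-filter-tabulate id (adj G x))) (regular x)

  count-closedNbr : ∀ x → count (closedNbr G x) ≡ suc d
  count-closedNbr x = begin
    count (closedNbr G x)                                  ≡⟨ ≡.sym (+-identityʳ _) ⟩
    count (closedNbr G x) + 0                              ≡⟨ cong (count (closedNbr G x) +_) (≡.sym (count-none _ loopless)) ⟩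
    count (closedNbr G x) + count (λ u → adj G x u ∧ does (x ≟ u)) ≡⟨ count-∨-∧ (adj G x) _ ⟩
    count (adj G x) + count (λ u → does (x ≟ u))           ≡⟨ cong₂ _+_ (count-adj x) (count-singleton x) ⟩
    d + 1                                                  ≡⟨ +-comm d 1 ⟩
    suc d                                                  ∎
    where
    open ≡-Reasoning
    loopless : ∀ u → ¬ T (adj G x u ∧ does (x ≟ u))
    loopless u t with x ≟ u
    ... | yes refl = contradiction (≡.subst T (irrefl G x) (proj₁ (Equivalence.to T-∧ t))) λ ()
    ... | no _     = contradiction (proj₂ (Equivalence.to (T-∧ {adj G x u}) t)) λ ()

  module _ {k} (n≡d+k+1 : d + k + 1 ≡ n) where

    count-nonNbr : ∀ x → count (nonNbr G x) ≡ k
    count-nonNbr x = +-cancelʳ-≡ (suc d) _ _ (begin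
      count (nonNbr G x) + suc d                 ≡⟨ cong (count (nonNbr G x) +_) (≡.sym (count-closedNbr x)) ⟩
      count (nonNbr G x) + count (closedNbr G x) ≡⟨ count-not (closedNbr G x) ⟩
      n                                          ≡⟨ ≡.sym n≡d+k+1 ⟩
      d + k + 1                                  ≡⟨ +-assoc d k 1 ⟩
      d + (k + 1)                                ≡⟨ +-comm d (k + 1) ⟩
      k + 1 + d                                  ≡⟨ +-assoc k 1 d ⟩
      k + suc d                                  ∎)
      where open ≡-Reasoning

    ∃-Nonadjacent : 0 < k → ∀ v → ∃[ u ] Nonadjacent G v u
    ∃-Nonadjacent 0<k v with 0<count⇒∃ (nonNbr G v) (≤-trans 0<k (≤-reflexive (≡.sym (count-nonNbr v))))
    ... | u , t = u , Equivalence.to (T-nonNbr G v u) t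

    covered⇒n≤m*[k+k] : ∀ {m} (a b : Fin m → Fin n) →
      (∀ v → ∃[ j ] (Nonadjacent G (a j) v ⊎ Nonadjacent G (b j) v)) → n ≤ m * (k + k)
    covered⇒n≤m*[k+k] {m} a b cover = begin
      n                        ≡⟨ ≡.sym count-true ⟩
      count {n} (λ _ → true)   ≤⟨ covered⇒count≤m*c (k + k) _ Q bound cover′ ⟩
      m * (k + k)              ∎
      where
      open ≤-Reasoning
      Q : Fin m → Fin n → Bool
      Q j v = nonNbr G (a j) v ∨ nonNbr G (b j) v
      bound : ∀ j → count (Q j) ≤ k + k
      bound j = ≤-trans (count-∨ (nonNbr G (a j)) (nonNbr G (b j))) (≤-reflexive (cong₂ _+_ (count-nonNbr (a j)) (count-nonNbr (b j))))
      cover′ : ∀ v → T true → ∃[ j ] T (Q j v)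
      cover′ v _ with cover v
      ... | j , inj₁ na = j , Equivalence.from T-∨ (inj₁ (Equivalence.from (T-nonNbr G (a j) v) na))
      ... | j , inj₂ nb = j , Equivalence.from T-∨ (inj₂ (Equivalence.from (T-nonNbr G (b j) v) nb))

module IntervalGraph {n} {H : Graph n} (l r : Fin n → ℕ) (l≤r : ∀ v → l v ≤ r v)
  (rep : ∀ u v → u ≢ v → T (adj H u v) ⇔ (l u ≤ r v × l v ≤ r u)) where

  <⇒Nonadjacent : ∀ {x y} → r x < l y → Nonadjacent H x y
  <⇒Nonadjacent {x} {y} rx<ly = x≢y , λ xy → <⇒≱ rx<ly (proj₂ (Equivalence.to (rep x y x≢y) xy))
    where
    x≢y : x ≢ y
    x≢y refl = <⇒≱ rx<ly (l≤r x)

  Nonadjacent⇒< : ∀ {x y} → Nonadjacent H x y → r x < l y ⊎ r y < l x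
  Nonadjacent⇒< {x} {y} (x≢y , ¬xy) with l x ≤? r y | l y ≤? r x
  ... | yes lx≤ry | yes ly≤rx = contradiction (Equivalence.from (rep x y x≢y) (lx≤ry , ly≤rx)) ¬xy
  ... | _         | no ly≰rx  = inj₁ (≰⇒> ly≰rx)
  ... | no lx≰ry  | yes _     = inj₂ (≰⇒> lx≰ry)

  extremes : Fin n → ∃[ a ] ∃[ b ] (∀ {v u} → Nonadjacent H v u → Nonadjacent H a v ⊎ Nonadjacent H b v)
  extremes x₀ = a , b , λ na → [ inj₂ ∘ left-of-b , inj₁ ∘ right-of-a ] (Nonadjacent⇒< na)
    where
    a = argmin r x₀ (allFin n)
    b = argmax l x₀ (allFin n)
    left-of-b : ∀ {v u} → r v < l u → Nonadjacent H b v
    left-of-b {u = u} rv<lu =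
      Nonadjacent-sym H (<⇒Nonadjacent (<-≤-trans rv<lu (lookup (f[xs]≤f[argmax] x₀ (allFin n)) (∈-allFin u))))
    right-of-a : ∀ {v u} → r u < l v → Nonadjacent H a v
    right-of-a {u = u} ru<lv =
      <⇒Nonadjacent (≤-<-trans (lookup (f[argmin]≤f[xs] x₀ (allFin n)) (∈-allFin u)) ru<lv)

interval-extremes : ∀ {n} {H : Graph n} → IsIntervalGraph H → Fin n →
  ∃[ a ] ∃[ b ] (∀ {v u} → Nonadjacent H v u → Nonadjacent H a v ⊎ Nonadjacent H b v)
interval-extremes {H = H} (l , r , l≤r , rep) = IntervalGraph.extremes {H = H} l r l≤r rep

module BoxRepresentation {n m} {G : Graph n} {I : Fin m → Graph n} (rep : IsBoxRepresentation G I) where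

  Nonadjacent⇒∃Nonadjacent : ∀ {u v} → Nonadjacent G u v → ∃[ j ] Nonadjacent (I j) u v
  Nonadjacent⇒∃Nonadjacent {u} {v} (u≢v , ¬uv) with
    ¬∀⟶∃¬ m (λ j → T (adj (I j) u v)) (λ j → T? (adj (I j) u v))
      (¬uv ∘ Equivalence.from (proj₂ rep u v u≢v))
  ... | j , ¬uvⱼ = j , u≢v , ¬uvⱼ

  Nonadjacent-factor : ∀ {j u v} → Nonadjacent (I j) u v → Nonadjacent G u v
  Nonadjacent-factor {j} {u} {v} (u≢v , ¬uvⱼ) = u≢v , λ uv → ¬uvⱼ (Equivalence.to (proj₂ rep u v u≢v) uv j)

theorem3 : (n k d : ℕ) (G : Graph n) → 1 ≤ k → d + k + 1 ≡ n → Regular d G →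
    (m : ℕ) → BoxicityAtMost G m → n ≤ 2 * k * m
theorem3 zero    k d G 1≤k n≡d+k+1 regular m box = z≤n
theorem3 (suc n) k d G 1≤k n≡d+k+1 regular m (I , rep) = begin
  suc n        ≤⟨ covered⇒n≤m*[k+k] n≡d+k+1 a b covered ⟩
  m * (k + k)  ≡⟨ *-comm m (k + k) ⟩
  (k + k) * m  ≡⟨ cong (λ k′ → (k + k′) * m) (≡.sym (+-identityʳ k)) ⟩
  2 * k * m    ∎
  where
  open ≤-Reasoning
  open RegularGraph {G = G} regular
  open BoxRepresentation {G = G} {I = I} rep
  extremes : ∀ j → ∃[ a ] ∃[ b ] (∀ {v u} → Nonadjacent (I j) v u → Nonadjacent (I j) a v ⊎ Nonadjacent (I j) b v)
  extremes j = interval-extremes {H = I j} (proj₁ rep j) zero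
  a b : Fin m → Fin (suc n)
  a j = proj₁ (extremes j)
  b j = proj₁ (proj₂ (extremes j))
  covered : ∀ v → ∃[ j ] (Nonadjacent G (a j) v ⊎ Nonadjacent G (b j) v)
  covered v with ∃-Nonadjacent n≡d+k+1 1≤k v
  ... | u , vu with Nonadjacent⇒∃Nonadjacent vu
  ...   | j , vuⱼ = j , Sum.map Nonadjacent-factor Nonadjacent-factor (proj₂ (proj₂ (extremes j)) vuⱼ)
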